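{- Let $\mathcal{X}$ be a finite totally ordered data universe, let $X=(x_1,\dots,x_n)$ be a stream with $x_i\in\mathcal{X}$, and let $\alpha>0$. Let $S(X)=\big((v_1,g_1,\Delta_1),\dots,(v_s,g_s,\Delta_s)\big)$ be the Greenwald–Khanna (GK) sketch of $X$ with approximation parameter $\alpha$, augmented with the sentinel tuples described in the context. For $x\in\mathcal{X}$ define $$r_{\min}(x)=|\{i\in[n]: x_i<x\}|,\qquad r_{\max}(x)=|\{i\in[n]: x_i\le x\}|,$$ $$\hat r_{\min}(x)=\max\Big\{\textstyle\sum_{j\le i} g_j : \mathrm{val}(v_i)<x\Big\},\qquad \hat r_{\max}(x)=\min\Big\{\Delta_i+\textstyle\sum_{j\le i} g_j : \mathrm{val}(v_i)>x\Big\}.$$ Then for every $x\in\mathcal{X}$, $$|r_{\min}(x)-\hat r_{\min}(x)|\le 2\alpha n\quad\text{and}\quad |r_{\max}(x)-\hat r_{\max}(x)|\le 2\alpha n.$$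
   Context: Stream elements are regarded as pairs $(x_i,i)$ with $\mathrm{val}((x_i,i))=x_i$; the index $\mathrm{ix}$ of a stream element is its position when the stream elements are sorted by value with ties broken by arrival index (a stable sort). The GK sketch with parameter $\alpha$ of a stream of length $n$ is a list of $s=O((1/\alpha)\log(\alpha n))$ tuples $(v_i,g_i,\Delta_i)$, where each $v_i$ is a stream element and $g_i,\Delta_i\in\mathbb{N}$, satisfying: (1) $\mathrm{ix}(v_i)\in[\sum_{j\le i}g_j,\ \Delta_i+\sum_{j\le i}g_j]$; (2) $g_i+\Delta_i\le 2\alpha n$; (3) the first tuple is (the minimum element, $1$, $0$) and the last is (the maximum element, $1$, $0$); (4) the $v_i$ are sorted in ascending (stable) order, and the sequences $\sum_{j\le i}g_j$ and $\Delta_i+\sum_{j\le i}g_j$ are nondecreasing in $i$. In addition, two formal tuples $(-\infty,0,0)$ and $(+\infty,0,0)$ are added at the beginning and end of the sketch (with rank intervals $[0,0]$ and $[n+1,n+1]$), so that the sets $\{i:\mathrm{val}(v_i)<x\}$ and $\{i:\mathrm{val}(v_i)>x\}$ are nonempty for every $x\in\mathcal{X}$; the bound $g_i+\Delta_i\le 2\alpha n$ still holds for all tuples.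
   Formalization: The approximation parameter α ranges over the positive rationals. -}

module Defs where

open import Data.Bool.Base using (Bool; true; false; _∧_; _∨_)
open import Data.Nat.Base as ℕ using (ℕ; zero; suc; _+_; _⊔_; _⊓_)
open import Data.Fin.Base as Fin using (Fin; zero; suc; fromℕ)
open import Data.Fin.Properties using (_<?_; _≤?_; _≟_)
open import Data.List.Base using (List; []; _∷_; _++_; map; foldr; length; filterᵇ; [_])
open import Data.List.Base using () renaming (allFin to allFinL)
open import Data.Product.Base using (_×_; _,_; proj₁; proj₂)
open import Data.Integer.Base using (+_)
open import Data.Rational.Base as ℚ using (ℚ; _/_)
open import Relation.Nullary.Decidable.Core using (⌊_⌋)
open import Relation.Binary.PropositionalEquality using (_≡_)

-- Data universe: the finite total order Fin m (m elements, usual order).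
-- A stream of length n over Fin m: x_i = X i  (i : Fin n, 0-based positions).
Stream : ℕ → ℕ → Set
Stream m n = Fin n → Fin m

ℕtoℚ : ℕ → ℚ
ℕtoℚ k = + k / 1

stableLeq : ∀ {m n} → Stream m n → Fin n → Fin n → Bool
stableLeq X i j = ⌊ X i <? X j ⌋ ∨ (⌊ X i ≟ X j ⌋ ∧ ⌊ i ≤? j ⌋)

-- ix((x_i,i)) : 1-based position of (x_i,i) in the stably sorted stream
ix : ∀ {m n} → Stream m n → Fin n → ℕ
ix {n = n} X i = length (filterᵇ (λ j → stableLeq X j i) (allFinL n))

rmin : ∀ {m n} → Stream m n → Fin m → ℕ
rmin {n = n} X x = length (filterᵇ (λ i → ⌊ X i <? x ⌋) (allFinL n))

rmax : ∀ {m n} → Stream m n → Fin m → ℕ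
rmax {n = n} X x = length (filterᵇ (λ i → ⌊ X i ≤? x ⌋) (allFinL n))

-- A (non-sentinel) sketch tuple (v, g, Δ); v is a stream element, given by its
-- arrival index (its value is X v).
record Tup (n : ℕ) : Set where
  constructor tup
  field
    v : Fin n
    g : ℕ
    Δ : ℕ
open Tup public

G : ∀ {n k} → (Fin k → Tup n) → Fin k → ℕ
G T zero    = g (T zero)
G T (suc i) = g (T zero) + G (λ j → T (suc j)) i

-- The GK invariants (1)-(4) for the non-sentinel tuples T 0 .. T s
-- (s+1 tuples, so the sketch is nonempty) with parameter α.
record IsGKSketch {m n : ℕ} (X : Stream m n) (α : ℚ) (s : ℕ)
                  (T : Fin (suc s) → Tup n) : Set where
  field
    rank-lo   : ∀ i → G T i ℕ.≤ ix X (v (T i))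
    rank-hi   : ∀ i → ix X (v (T i)) ℕ.≤ Δ (T i) + G T i
    gΔ-bound  : ∀ i → ℕtoℚ (g (T i) + Δ (T i)) ℚ.≤ ℕtoℚ 2 ℚ.* α ℚ.* ℕtoℚ n
    first-min : ∀ j → stableLeq X (v (T zero)) j ≡ true
    first-g   : g (T zero) ≡ 1
    first-Δ   : Δ (T zero) ≡ 0
    last-max  : ∀ j → stableLeq X j (v (T (fromℕ s))) ≡ true
    last-g    : g (T (fromℕ s)) ≡ 1
    last-Δ    : Δ (T (fromℕ s)) ≡ 0
    sorted    : ∀ i j → i Fin.≤ j → stableLeq X (v (T i)) (v (T j)) ≡ true
    G-mono    : ∀ i j → i Fin.≤ j → G T i ℕ.≤ G T j
    ΔG-mono   : ∀ i j → i Fin.≤ j → Δ (T i) + G T i ℕ.≤ Δ (T j) + G T j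

-- Extended values, for the formal sentinel tuples (-∞,0,0) and (+∞,0,0).
data Ext (m : ℕ) : Set where
  -∞ : Ext m
  val : Fin m → Ext m
  +∞ : Ext m

_<ᴱ_ : ∀ {m} → Ext m → Fin m → Bool
-∞    <ᴱ x = true
val y <ᴱ x = ⌊ y <? x ⌋
+∞    <ᴱ x = false

_>ᴱ_ : ∀ {m} → Ext m → Fin m → Bool
-∞    >ᴱ x = false
val y >ᴱ x = ⌊ x <? y ⌋
+∞    >ᴱ x = true

-- The sentinel (-∞,0,0) comes first (prefix sum 0); the sentinel (+∞,0,0)
-- comes last, its prefix sum being the total Σ_j g_j = G T (last).
augmented : ∀ {m n s} → Stream m n → (Fin (suc s) → Tup n) → List (Ext m × ℕ × ℕ)
augmented {s = s} X T =
  (-∞ , 0 , 0)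
  ∷ map (λ i → (val (X (v (T i))) , G T i , Δ (T i) + G T i)) (allFinL (suc s))
  ++ [ (+∞ , G T (fromℕ s) , 0 + G T (fromℕ s)) ]

maxList : List ℕ → ℕ
maxList = foldr _⊔_ 0

-- minimum of a list (only applied to nonempty lists; the +∞ sentinel is always there)
minList : List ℕ → ℕ
minList []       = 0
minList (a ∷ as) = foldr _⊓_ a as

rminHat : ∀ {m n s} → Stream m n → (Fin (suc s) → Tup n) → Fin m → ℕ
rminHat X T x =
  maxList (map (λ t → proj₁ (proj₂ t)) (filterᵇ (λ t → proj₁ t <ᴱ x) (augmented X T)))

rmaxHat : ∀ {m n s} → Stream m n → (Fin (suc s) → Tup n) → Fin m → ℕ
rmaxHat X T x =
  minList (map (λ t → proj₂ (proj₂ t)) (filterᵇ (λ t → proj₁ t >ᴱ x) (augmented X T)))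

-- Every stream element v of the sketch has its index pinned between its two
-- rank bounds, and ix(v) compares with r_min(x), r_max(x) according to how
-- val(v) compares with x.  This gives r̂_min ≤ r_min and r_max ≤ r̂_max
-- directly.  For the other direction walk along the sketch to the first tuple
-- i on the far side of x: the rank bound Δ_i + Σ_{j≤i} g_j of that tuple
-- exceeds the prefix sum Σ_{j<i} g_j of its predecessor, which lies on the near
-- side, by exactly g_i + Δ_i ≤ 2αn.  If no tuple is on the far side, the
-- sentinels do the job, since the total Σ g_j is at least n.
module Submission where

open import Defs
open import Data.Nat.Base using (ℕ; suc; ∣_-_∣)
open import Data.Fin.Base using (Fin)
open import Data.Product.Base using (_×_)
open import Data.Rational.Base using (ℚ; 0ℚ; _<_; _≤_; _*_)

open import Level using (Level)
open import Function.Base using (_∘_; case_of_)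
open import Function.Bundles using (Equivalence)
open import Data.Bool.Base using (Bool; T; true)
open import Data.Bool.Properties using (T-≡)
open import Data.Nat.Base as ℕ using (zero; _+_; z≤n)
open import Data.Nat.Properties as ℕ
  using (≤-trans; ≤-reflexive; +-comm; +-assoc; m≤m+n; m≤n+m; +-monoˡ-≤; module ≤-Reasoning)
open import Data.Fin.Base as Fin using (zero; suc; fromℕ; inject₁; toℕ)
open import Data.Fin.Properties using (_<?_; _≤?_; _≟_)
open import Data.List.Base using (List; []; _∷_; map; foldr; length; filterᵇ)
  renaming (allFin to allFinL)
open import Data.List.Properties using (length-filter; filter-all; length-tabulate)
open import Data.List.Membership.Propositional using (_∈_)
open import Data.List.Membership.Propositional.Properties
  using (∈-map⁺; ∈-map⁻; ∈-++⁺ˡ; ∈-++⁺ʳ; ∈-++⁻; ∈-allFin; ∈-filter⁺; ∈-map∘filter⁻)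
open import Data.List.Relation.Unary.Any using (here; there)
import Data.List.Relation.Unary.All as All
open import Data.List.Relation.Binary.Sublist.Propositional using (⊆-refl)
open import Data.List.Relation.Binary.Sublist.Heterogeneous.Properties
  using (length-mono-≤; ⊆-filter-Sublist)
open import Data.Product.Base using (_,_; proj₁; proj₂; ∃; map₂)
open import Data.Sum.Base using (_⊎_; inj₁; inj₂)
import Data.Integer.Base as ℤ
import Data.Integer.Properties as ℤ
import Data.Rational.Base as ℚ
import Data.Rational.Properties as ℚ
open import Data.Nat.Divisibility using (∣1⇒≡1)
open import Relation.Nullary using (¬_; yes; no; contradiction)
open import Relation.Nullary.Decidable using (⌊_⌋; T?; toWitness; fromWitness)
open import Relation.Unary using (Pred; Decidable)
open import Relation.Binary.PropositionalEquality
  using (_≡_; refl; sym; trans; cong; subst₂; module ≡-Reasoning)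

private
  variable
    ℓ : Level
    A : Set

length-filterᵇ-mono : {p q : A → Bool} → (∀ {a} → T (p a) → T (q a)) →
                      ∀ xs → length (filterᵇ p xs) ℕ.≤ length (filterᵇ q xs)
length-filterᵇ-mono {p = p} {q} p⇒q xs =
  length-mono-≤ (⊆-filter-Sublist (T? ∘ p) (T? ∘ q) (λ { refl → p⇒q }) (⊆-refl {x = xs}))

length-allFin : ∀ n → length (allFinL n) ≡ n
length-allFin n = length-tabulate (λ i → i)

∈⇒≤maxList : ∀ {y} xs → y ∈ xs → y ℕ.≤ maxList xs
∈⇒≤maxList (x ∷ xs) (here refl) = ℕ.m≤m⊔n x (maxList xs)
∈⇒≤maxList (x ∷ xs) (there y∈) = ≤-trans (∈⇒≤maxList xs y∈) (ℕ.m≤n⊔m x (maxList xs))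

maxList≤ : ∀ {b} xs → (∀ {y} → y ∈ xs → y ℕ.≤ b) → maxList xs ℕ.≤ b
maxList≤ []       _     = z≤n
maxList≤ (x ∷ xs) bound = ℕ.⊔-lub (bound (here refl)) (maxList≤ xs (bound ∘ there))

-- minList (x ∷ xs) folds _⊓_ starting from x, so x plays the role of the last element.
∈⇒minList≤ : ∀ {y} xs → y ∈ xs → minList xs ℕ.≤ y
∈⇒minList≤ (x ∷ xs) = go xs
  where
  go : ∀ {y} ys → y ∈ x ∷ ys → foldr ℕ._⊓_ x ys ℕ.≤ y
  go []       (here refl)         = ℕ.≤-refl
  go (z ∷ zs) (here refl)         = ≤-trans (ℕ.m⊓n≤n z _) (go zs (here refl))
  go (z ∷ zs) (there (here refl)) = ℕ.m⊓n≤m z _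
  go (z ∷ zs) (there (there y∈))  = ≤-trans (ℕ.m⊓n≤n z _) (go zs (there y∈))

≤minList : ∀ {c y} xs → y ∈ xs → (∀ {z} → z ∈ xs → c ℕ.≤ z) → c ℕ.≤ minList xs
≤minList (x ∷ xs) _ bound = go xs bound
  where
  go : ∀ {c} ys → (∀ {z} → z ∈ x ∷ ys → c ℕ.≤ z) → c ℕ.≤ foldr ℕ._⊓_ x ys
  go []       bound = bound (here refl)
  go (z ∷ zs) bound = ℕ.⊓-glb (bound (there (here refl)))
    (go zs λ { (here refl) → bound (here refl) ; (there z∈) → bound (there (there z∈)) })

m≤n≤m+o⇒∣n-m∣≤o : ∀ {m n o} → m ℕ.≤ n → n ℕ.≤ m + o → ∣ n - m ∣ ℕ.≤ o
m≤n≤m+o⇒∣n-m∣≤o {m} {n} m≤n n≤m+o =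
  ≤-trans (≤-reflexive (ℕ.m≤n⇒∣n-m∣≡n∸m m≤n)) (ℕ.m≤n+o⇒m∸n≤o n m n≤m+o)

ℕtoℚ≡mkℚ : ∀ k → ℕtoℚ k ≡ ℚ.mkℚ (ℤ.+ k) 0 _
ℕtoℚ≡mkℚ k = ℚ.normalize-coprime {k} {0} (λ { (_ , d∣1) → ∣1⇒≡1 d∣1 })

ℕtoℚ-mono-≤ : ∀ {a b} → a ℕ.≤ b → ℕtoℚ a ≤ ℕtoℚ b
ℕtoℚ-mono-≤ {a} {b} a≤b = subst₂ _≤_ (sym (ℕtoℚ≡mkℚ a)) (sym (ℕtoℚ≡mkℚ b))
  (ℚ.*≤* (subst₂ ℤ._≤_ (sym (ℤ.*-identityʳ (ℤ.+ a))) (sym (ℤ.*-identityʳ (ℤ.+ b))) (ℤ.+≤+ a≤b)))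

width : ∀ {n} → Tup n → ℕ
width t = g t + Δ t

first-crossing : ∀ {s} {P : Pred (Fin (suc s)) ℓ} → Decidable P → P (fromℕ s) →
                 P zero ⊎ ∃ λ k → ¬ P (inject₁ k) × P (suc k)
first-crossing {s = zero}  P? P-last = inj₁ P-last
first-crossing {s = suc s} P? P-last with P? zero
... | yes P₀ = inj₁ P₀
... | no ¬P₀ with first-crossing (P? ∘ suc) P-last
...   | inj₁ P₁                = inj₂ (zero , ¬P₀ , P₁)
...   | inj₂ (k , ¬Pₖ , Pₖ₊₁) = inj₂ (suc k , ¬Pₖ , Pₖ₊₁)

module _ {n : ℕ} where

  G-suc : ∀ {s} (S : Fin (suc s) → Tup n) k → G S (suc k) ≡ G S (inject₁ k) + g (S (suc k))
  G-suc S zero    = refl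
  G-suc S (suc k) = begin
    g (S zero) + G (S ∘ suc) (suc k)                             ≡⟨ cong (g (S zero) +_) (G-suc (S ∘ suc) k) ⟩
    g (S zero) + (G (S ∘ suc) (inject₁ k) + g (S (suc (suc k)))) ≡⟨ sym (+-assoc (g (S zero)) _ _) ⟩
    G S (inject₁ (suc k)) + g (S (suc (suc k)))                  ∎
    where open ≡-Reasoning

  upper-rank-suc : ∀ {s} (S : Fin (suc s) → Tup n) k →
                   Δ (S (suc k)) + G S (suc k) ≡ G S (inject₁ k) + width (S (suc k))
  upper-rank-suc S k = begin
    Δ (S (suc k)) + G S (suc k)                         ≡⟨ cong (Δ (S (suc k)) +_) (G-suc S k) ⟩
    Δ (S (suc k)) + (G S (inject₁ k) + g (S (suc k)))   ≡⟨ +-comm (Δ (S (suc k))) _ ⟩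
    G S (inject₁ k) + g (S (suc k)) + Δ (S (suc k))     ≡⟨ +-assoc (G S (inject₁ k)) _ _ ⟩
    G S (inject₁ k) + width (S (suc k))                 ∎
    where open ≡-Reasoning

  crossing-width-bound : ∀ {s} (S : Fin (suc s) → Tup n) {P : Pred (Fin (suc s)) ℓ} → Decidable P →
                         ∀ {a b} → (∀ i → ¬ P i → G S i ℕ.≤ a) → (∀ i → P i → b ℕ.≤ Δ (S i) + G S i) →
                         b ℕ.≤ G S (fromℕ s) → ∃ λ i → b ℕ.≤ a + width (S i)
  crossing-width-bound {s = s} S P? {a} {b} below above b≤total with P? (fromℕ s)
  ... | no ¬P-last = fromℕ s , ≤-trans b≤total (≤-trans (below _ ¬P-last) (m≤m+n a _))
  ... | yes P-last with first-crossing P? P-last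
  ...   | inj₁ P₀ = zero , ≤-trans (above zero P₀)
                                   (≤-trans (≤-reflexive (+-comm (Δ (S zero)) _)) (m≤n+m _ a))
  ...   | inj₂ (k , ¬Pₖ , Pₖ₊₁) = suc k , (begin
    b                                   ≤⟨ above (suc k) Pₖ₊₁ ⟩
    Δ (S (suc k)) + G S (suc k)         ≡⟨ upper-rank-suc S k ⟩
    G S (inject₁ k) + width (S (suc k)) ≤⟨ +-monoˡ-≤ _ (below _ ¬Pₖ) ⟩
    a + width (S (suc k))               ∎)
    where open ≤-Reasoning

module _ {m n : ℕ} (X : Stream m n) where

  stableLeq⇒≤ : ∀ {k j} → T (stableLeq X k j) → X k Fin.≤ X j
  stableLeq⇒≤ {k} {j} k≼j with X k <? X j | X k ≟ X j
  ... | yes k<j | _       = ℕ.<⇒≤ k<j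
  ... | no _    | yes k≡j = ≤-reflexive (cong toℕ k≡j)

  <⇒stableLeq : ∀ {k j} → X k Fin.< X j → T (stableLeq X k j)
  <⇒stableLeq {k} {j} k<j with X k <? X j
  ... | yes _   = _
  ... | no k≮j = contradiction k<j k≮j

  ix-of-maximum : ∀ j → (∀ k → stableLeq X k j ≡ true) → ix X j ≡ n
  ix-of-maximum j max = trans
    (cong length (filter-all (T? ∘ λ k → stableLeq X k j) (All.universal (Equivalence.from T-≡ ∘ max) (allFinL n))))
    (length-allFin n)

  module _ (x : Fin m) where

    rmin≤n : rmin X x ℕ.≤ n
    rmin≤n = ≤-trans (length-filter (T? ∘ λ i → ⌊ X i <? x ⌋) (allFinL n)) (≤-reflexive (length-allFin n))

    rmax≤n : rmax X x ℕ.≤ n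
    rmax≤n = ≤-trans (length-filter (T? ∘ λ i → ⌊ X i ≤? x ⌋) (allFinL n)) (≤-reflexive (length-allFin n))

    ix≤rmin : ∀ j → X j Fin.< x → ix X j ℕ.≤ rmin X x
    ix≤rmin j Xj<x = length-filterᵇ-mono (λ k≼j → fromWitness (ℕ.≤-<-trans (stableLeq⇒≤ k≼j) Xj<x)) (allFinL n)

    rmin≤ix : ∀ j → x Fin.≤ X j → rmin X x ℕ.≤ ix X j
    rmin≤ix j x≤Xj = length-filterᵇ-mono (λ Xk<x → <⇒stableLeq (ℕ.<-≤-trans (toWitness Xk<x) x≤Xj)) (allFinL n)

    ix≤rmax : ∀ j → X j Fin.≤ x → ix X j ℕ.≤ rmax X x
    ix≤rmax j Xj≤x = length-filterᵇ-mono (λ k≼j → fromWitness (≤-trans (stableLeq⇒≤ k≼j) Xj≤x)) (allFinL n)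

    rmax≤ix : ∀ j → x Fin.< X j → rmax X x ℕ.≤ ix X j
    rmax≤ix j x<Xj = length-filterᵇ-mono (λ Xk≤x → <⇒stableLeq (ℕ.≤-<-trans (toWitness Xk≤x) x<Xj)) (allFinL n)

module _ {m n s : ℕ} (X : Stream m n) (S : Fin (suc s) → Tup n) where

  entry : Fin (suc s) → Ext m × ℕ × ℕ
  entry i = (val (X (v (S i))) , G S i , Δ (S i) + G S i)

  total : ℕ
  total = G S (fromℕ s)

  entry∈augmented : ∀ i → entry i ∈ augmented X S
  entry∈augmented i = there (∈-++⁺ˡ (∈-map⁺ entry (∈-allFin i)))

  +∞∈augmented : (+∞ , total , total) ∈ augmented X S
  +∞∈augmented = there (∈-++⁺ʳ (map entry (allFinL (suc s))) (here refl))

  ∈-augmented⁻ : ∀ {t} → t ∈ augmented X S →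
                 t ≡ (-∞ , 0 , 0) ⊎ (∃ λ i → t ≡ entry i) ⊎ t ≡ (+∞ , total , total)
  ∈-augmented⁻ (here t≡-∞) = inj₁ t≡-∞
  ∈-augmented⁻ (there t∈) with ∈-++⁻ (map entry (allFinL (suc s))) t∈
  ... | inj₁ t∈entries with ∈-map⁻ entry t∈entries
  ...   | i , _ , t≡entry = inj₂ (inj₁ (i , t≡entry))
  ∈-augmented⁻ (there t∈) | inj₂ (here t≡+∞) = inj₂ (inj₂ t≡+∞)

  module _ (x : Fin m) where

    private
      left-of-x : Ext m × ℕ × ℕ → Bool
      left-of-x t = proj₁ t <ᴱ x

      right-of-x : Ext m × ℕ × ℕ → Bool
      right-of-x t = proj₁ t >ᴱ x

      lower-ranks : List ℕ
      lower-ranks = map (proj₁ ∘ proj₂) (filterᵇ left-of-x (augmented X S))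

      upper-ranks : List ℕ
      upper-ranks = map (proj₂ ∘ proj₂) (filterᵇ right-of-x (augmented X S))

      +∞∈upper-ranks : total ∈ upper-ranks
      +∞∈upper-ranks = ∈-map⁺ (proj₂ ∘ proj₂) (∈-filter⁺ (T? ∘ right-of-x) +∞∈augmented _)

    rminHat-ub : ∀ i → X (v (S i)) Fin.< x → G S i ℕ.≤ rminHat X S x
    rminHat-ub i vᵢ<x = ∈⇒≤maxList lower-ranks (∈-map⁺ (proj₁ ∘ proj₂)
      (∈-filter⁺ (T? ∘ left-of-x) (entry∈augmented i) (fromWitness vᵢ<x)))

    rminHat-lub : ∀ {b} → (∀ i → X (v (S i)) Fin.< x → G S i ℕ.≤ b) → rminHat X S x ℕ.≤ b
    rminHat-lub {b} bound = maxList≤ lower-ranks λ y∈ →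
      case ∈-map∘filter⁻ (proj₁ ∘ proj₂) (T? ∘ left-of-x) {xs = augmented X S} y∈ of
        λ { (t , t∈ , refl , t<x) → go t∈ t<x }
      where
      go : ∀ {t} → t ∈ augmented X S → T (left-of-x t) → proj₁ (proj₂ t) ℕ.≤ b
      go t∈ t<x with ∈-augmented⁻ t∈
      ... | inj₁ refl              = z≤n
      ... | inj₂ (inj₁ (i , refl)) = bound i (toWitness t<x)
      go t∈ () | inj₂ (inj₂ refl)

    rmaxHat-ub : ∀ i → x Fin.< X (v (S i)) → rmaxHat X S x ℕ.≤ Δ (S i) + G S i
    rmaxHat-ub i x<vᵢ = ∈⇒minList≤ upper-ranks (∈-map⁺ (proj₂ ∘ proj₂)
      (∈-filter⁺ (T? ∘ right-of-x) (entry∈augmented i) (fromWitness x<vᵢ)))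

    rmaxHat≤total : rmaxHat X S x ℕ.≤ total
    rmaxHat≤total = ∈⇒minList≤ upper-ranks +∞∈upper-ranks

    rmaxHat-glb : ∀ {b} → (∀ i → x Fin.< X (v (S i)) → b ℕ.≤ Δ (S i) + G S i) → b ℕ.≤ total →
                  b ℕ.≤ rmaxHat X S x
    rmaxHat-glb {b} bound b≤total = ≤minList upper-ranks +∞∈upper-ranks λ y∈ →
      case ∈-map∘filter⁻ (proj₂ ∘ proj₂) (T? ∘ right-of-x) {xs = augmented X S} y∈ of
          λ { (t , t∈ , refl , x<t) → go t∈ x<t }
      where
      go : ∀ {t} → t ∈ augmented X S → T (right-of-x t) → b ℕ.≤ proj₂ (proj₂ t)
      go t∈ x<t with ∈-augmented⁻ t∈
      go t∈ () | inj₁ refl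
      ... | inj₂ (inj₁ (i , refl)) = bound i (toWitness x<t)
      ... | inj₂ (inj₂ refl)       = b≤total

module _ {m n s : ℕ} {X : Stream m n} {α : ℚ} {S : Fin (suc s) → Tup n}
         (gk : IsGKSketch X α s S) where

  open IsGKSketch gk

  n≤total : n ℕ.≤ total X S
  n≤total = begin
    n                                        ≡⟨ sym (ix-of-maximum X _ last-max) ⟩
    ix X (v (S (fromℕ s)))                   ≤⟨ rank-hi (fromℕ s) ⟩
    Δ (S (fromℕ s)) + G S (fromℕ s)          ≡⟨ cong (_+ G S (fromℕ s)) last-Δ ⟩
    G S (fromℕ s)                            ∎
    where open ≤-Reasoning

  width-bound : ∀ {e} → ∃ (λ i → e ℕ.≤ width (S i)) → ℕtoℚ e ≤ ℕtoℚ 2 * α * ℕtoℚ n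
  width-bound (i , e≤width) = ℚ.≤-trans (ℕtoℚ-mono-≤ e≤width) (gΔ-bound i)

  module _ (x : Fin m) where

    rminHat≤rmin : rminHat X S x ℕ.≤ rmin X x
    rminHat≤rmin = rminHat-lub X S x λ i vᵢ<x → ≤-trans (rank-lo i) (ix≤rmin X x _ vᵢ<x)

    rmin≤rminHat+width : ∃ λ i → rmin X x ℕ.≤ rminHat X S x + width (S i)
    rmin≤rminHat+width = crossing-width-bound S (λ i → x ≤? X (v (S i)))
      (λ i x≰vᵢ → rminHat-ub X S x i (ℕ.≰⇒> x≰vᵢ))
      (λ i x≤vᵢ → ≤-trans (rmin≤ix X x _ x≤vᵢ) (rank-hi i))
      (≤-trans (rmin≤n X x) n≤total)

    rmax≤rmaxHat : rmax X x ℕ.≤ rmaxHat X S x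
    rmax≤rmaxHat = rmaxHat-glb X S x (λ i x<vᵢ → ≤-trans (rmax≤ix X x _ x<vᵢ) (rank-hi i))
      (≤-trans (rmax≤n X x) n≤total)

    rmaxHat≤rmax+width : ∃ λ i → rmaxHat X S x ℕ.≤ rmax X x + width (S i)
    rmaxHat≤rmax+width = crossing-width-bound S (λ i → x <? X (v (S i)))
      (λ i x≮vᵢ → ≤-trans (rank-lo i) (ix≤rmax X x _ (ℕ.≮⇒≥ x≮vᵢ)))
      (λ i x<vᵢ → rmaxHat-ub X S x i x<vᵢ)
      (rmaxHat≤total X S x)

    rmin-error : ∃ λ i → ∣ rmin X x - rminHat X S x ∣ ℕ.≤ width (S i)
    rmin-error = map₂ (m≤n≤m+o⇒∣n-m∣≤o rminHat≤rmin) rmin≤rminHat+width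

    rmax-error : ∃ λ i → ∣ rmax X x - rmaxHat X S x ∣ ℕ.≤ width (S i)
    rmax-error = map₂ (λ rmaxHat≤ → ≤-trans (≤-reflexive (ℕ.∣-∣-comm (rmax X x) _))
                                            (m≤n≤m+o⇒∣n-m∣≤o rmax≤rmaxHat rmaxHat≤))
                      rmaxHat≤rmax+width

lemma4p3 : ∀ {m n s : ℕ} (X : Stream m n) (α : ℚ) (T : Fin (suc s) → Tup n)
    → 0ℚ < α
    → IsGKSketch X α s T
    → ∀ (x : Fin m)
    → (ℕtoℚ ∣ rmin X x - rminHat X T x ∣ ≤ ℕtoℚ 2 * α * ℕtoℚ n)
      × (ℕtoℚ ∣ rmax X x - rmaxHat X T x ∣ ≤ ℕtoℚ 2 * α * ℕtoℚ n)
lemma4p3 X α S _ gk x = width-bound gk (rmin-error gk x) , width-bound gk (rmax-error gk x)
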